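{- Let $k$ be a prime, $n$ a positive integer, and let $A \subseteq \{1,2,\dots,n\}$ contain no $k$-term arithmetic progression. Define $$A_k = \{(a-1)k + j : a \in A,\ j \in \{1,2,\dots,k-1\}\}.$$ Then $A_k$ contains no $k$-term arithmetic progression.
   Context: A $k$-term arithmetic progression ($k$-AP) is a sequence $a, a+d, \dots, a+(k-1)d$ of integers with common difference $d \ge 1$. -}

module Defs where

open import Data.Nat using (ℕ; _+_; _*_; _∸_; _≤_; _<_)
open import Data.Product using (Σ; _×_; ∃-syntax)
open import Relation.Binary.PropositionalEquality using (_≡_)

NatSet : Set₁
NatSet = ℕ → Set

SubsetUpTo : ℕ → NatSet → Set
SubsetUpTo n S = ∀ x → S x → (1 ≤ x) × (x ≤ n)

-- S contains a k-term arithmetic progression a, a+d, ..., a+(k-1)d with d ≥ 1.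
-- (All sets considered consist of positive integers, so a ∈ ℕ suffices.)
HasAP : ℕ → NatSet → Set
HasAP k S = ∃[ a ] ∃[ d ] ((1 ≤ d) × (∀ i → i < k → S (a + i * d)))

Blowup : ℕ → NatSet → NatSet
Blowup k A x = ∃[ a ] ∃[ j ] (A a × (1 ≤ j) × (j ≤ k ∸ 1) × (x ≡ (a ∸ 1) * k + j))

-- No element of A_k is divisible by k, and the quotient by k of each of them,
-- plus one, lies in A. Let b + i d (i < k) be a k-AP in A_k. If k ∣ d, dividing by k
-- turns it into the k-AP (b / k + 1) + i (d / k) inside A. Otherwise d is coprime to
-- the prime k, so i ↦ b + i d runs through every residue class mod k and some term
-- is divisible by k, which is impossible in A_k.
module Submission where

open import Defs
open import Data.Nat using (ℕ; zero; suc; _+_; _*_; _∸_; _≤_; _<_; NonZero; >-nonZero)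
open import Data.Nat.Properties
open import Data.Nat.DivMod using (_/_; _%_; m≡m%n+[m/n]*n; m%n<n; m*n/n≡m; m<n⇒m/n≡0; +-distrib-/-∣ʳ)
open import Data.Nat.Divisibility using (_∣_; _∤_; divides; _∣?_; ∣⇒≤; ∣m+n∣m⇒∣n; ∣n⇒∣m*n)
open import Data.Nat.Coprimality using (Coprime; coprime-Bézout)
open import Data.Nat.GCD using (module Bézout)
open import Data.Nat.Primality using (Prime; prime⇒irreducible; ¬prime[0])
open import Data.Nat.Tactic.RingSolver using (solve-∀)
open import Data.Product using (_,_; _×_; proj₁; ∃-syntax)
open import Data.Sum using (inj₁; inj₂)
open import Data.Empty using (⊥-elim)
open import Relation.Nullary using (¬_; yes; no)
open import Relation.Binary.PropositionalEquality
open ≡-Reasoning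

[m+n*d]/d≡m/d+n : ∀ m n d .{{_ : NonZero d}} → (m + n * d) / d ≡ m / d + n
[m+n*d]/d≡m/d+n m n d = begin
  (m + n * d) / d     ≡⟨ +-distrib-/-∣ʳ m (divides n refl) ⟩
  m / d + n * d / d   ≡⟨ cong (m / d +_) (m*n/n≡m n d) ⟩
  m / d + n           ∎

prime∧∤⇒coprime : ∀ {p n} → Prime p → p ∤ n → Coprime p n
prime∧∤⇒coprime pp p∤n (c∣p , c∣n) with prime⇒irreducible pp c∣p
... | inj₁ c≡1 = c≡1
... | inj₂ refl = ⊥-elim (p∤n c∣n)

-- y is an inverse of -d modulo k; the Bézout identity only yields one up to sign,
-- and in the second case multiplying by k - 1 flips the sign.
coprime⇒∃[-d]⁻¹ : ∀ {k d} → Coprime (suc k) d → ∃[ y ] suc k ∣ 1 + y * d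
coprime⇒∃[-d]⁻¹ cop with coprime-Bézout cop
... | Bézout.+- x y 1+yd≡xk = y , divides x 1+yd≡xk
coprime⇒∃[-d]⁻¹ {k} {d} cop | Bézout.-+ x y 1+xk≡yd =
  k * y , divides (1 + k * x) (begin
    1 + k * y * d          ≡⟨ cong (1 +_) (*-assoc k y d) ⟩
    1 + k * (y * d)        ≡⟨ cong (λ z → 1 + k * z) (sym 1+xk≡yd) ⟩
    1 + k * (1 + x * suc k) ≡⟨ ring k x ⟩
    (1 + k * x) * suc k    ∎)
  where
  ring : ∀ k x → 1 + k * (1 + x * suc k) ≡ (1 + k * x) * suc k
  ring = solve-∀

∣+*⇒∣+*% : ∀ {k} .{{_ : NonZero k}} b d t → k ∣ b + t * d → k ∣ b + (t % k) * d
∣+*⇒∣+*% {k} b d t k∣b+td = ∣m+n∣m⇒∣n (subst (k ∣_) split k∣b+td) (divides (t / k * d) refl)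
  where
  ring : ∀ b r q d k → b + (r + q * k) * d ≡ (q * d) * k + (b + r * d)
  ring = solve-∀
  split : b + t * d ≡ (t / k * d) * k + (b + (t % k) * d)
  split = begin
    b + t * d                         ≡⟨ cong (λ u → b + u * d) (m≡m%n+[m/n]*n t k) ⟩
    b + (t % k + t / k * k) * d       ≡⟨ ring b (t % k) (t / k) d k ⟩
    (t / k * d) * k + (b + (t % k) * d) ∎

coprime⇒AP-hits-multiple : ∀ {k d} → Coprime (suc k) d → ∀ b →
                           ∃[ i ] (i < suc k) × (suc k ∣ b + i * d)
coprime⇒AP-hits-multiple {k} {d} cop b with coprime⇒∃[-d]⁻¹ cop
... | y , k∣1+yd = b * y % suc k , m%n<n (b * y) (suc k) ,
                   ∣+*⇒∣+*% b d (b * y) (subst (suc k ∣_) (ring b y d) (∣n⇒∣m*n b k∣1+yd))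
  where
  ring : ∀ b y d → b * (1 + y * d) ≡ b + b * y * d
  ring = solve-∀

[b+i*[e*k]]/k+1≡b/k+1+i*e : ∀ {k} .{{_ : NonZero k}} b e i → (b + i * (e * k)) / k + 1 ≡ b / k + 1 + i * e
[b+i*[e*k]]/k+1≡b/k+1+i*e {k} b e i = begin
  (b + i * (e * k)) / k + 1 ≡⟨ cong (λ z → (b + z) / k + 1) (sym (*-assoc i e k)) ⟩
  (b + i * e * k) / k + 1   ≡⟨ cong (_+ 1) ([m+n*d]/d≡m/d+n b (i * e) k) ⟩
  b / k + i * e + 1         ≡⟨ +-assoc (b / k) (i * e) 1 ⟩
  b / k + (i * e + 1)       ≡⟨ cong (b / k +_) (+-comm (i * e) 1) ⟩
  b / k + (1 + i * e)       ≡⟨ +-assoc (b / k) 1 (i * e) ⟨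
  b / k + 1 + i * e         ∎

module _ {k : ℕ} .{{_ : NonZero k}} {A : NatSet} where

  Blowup-∤ : ∀ {x} → Blowup k A x → k ∤ x
  Blowup-∤ (a , j , _ , j≥1 , j≤k-1 , refl) k∣x = <⇒≱ (m≤pred[n]⇒suc[m]≤n j≤k-1) (∣⇒≤ k∣j)
    where
    instance
      j≢0 : NonZero j
      j≢0 = >-nonZero j≥1
    k∣j : k ∣ j
    k∣j = ∣m+n∣m⇒∣n k∣x (divides (a ∸ 1) refl)

  -- The "+ 1" undoes the shift a - 1, which needs every element of A to be positive.
  Blowup⇒[x/k+1]∈A : (∀ a → A a → 1 ≤ a) → ∀ {x} → Blowup k A x → A (x / k + 1)
  Blowup⇒[x/k+1]∈A positive (a , j , a∈A , _ , j≤k-1 , refl) = subst A (sym quotient) a∈A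
    where
    quotient : ((a ∸ 1) * k + j) / k + 1 ≡ a
    quotient = begin
      ((a ∸ 1) * k + j) / k + 1 ≡⟨ cong (λ z → z / k + 1) (+-comm ((a ∸ 1) * k) j) ⟩
      (j + (a ∸ 1) * k) / k + 1 ≡⟨ cong (_+ 1) ([m+n*d]/d≡m/d+n j (a ∸ 1) k) ⟩
      j / k + (a ∸ 1) + 1       ≡⟨ cong (λ z → z + (a ∸ 1) + 1) (m<n⇒m/n≡0 (m≤pred[n]⇒suc[m]≤n j≤k-1)) ⟩
      (a ∸ 1) + 1               ≡⟨ m∸n+n≡m (positive a a∈A) ⟩
      a                         ∎

lemma1 : (k n : ℕ) → Prime k → 1 ≤ n → (A : NatSet) → SubsetUpTo n A →
         ¬ HasAP k A → ¬ HasAP k (Blowup k A)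
lemma1 zero _ 0-prime = ⊥-elim (¬prime[0] 0-prime)
lemma1 k@(suc _) _ k-prime _ A A⊆[1,n] A-AP-free (b , d , d≥1 , AP⊆Aₖ) with k ∣? d
... | yes (divides e refl) = A-AP-free (b / k + 1 , e , e≥1 , AP⊆A)
  where
  e≥1 : 1 ≤ e
  e≥1 = n≢0⇒n>0 (λ { refl → 1+n≰n d≥1 })
  AP⊆A : ∀ i → i < k → A (b / k + 1 + i * e)
  AP⊆A i i<k = subst A ([b+i*[e*k]]/k+1≡b/k+1+i*e b e i)
                 (Blowup⇒[x/k+1]∈A (λ a a∈A → proj₁ (A⊆[1,n] a a∈A)) (AP⊆Aₖ i i<k))
... | no k∤d =
  let i , i<k , k∣term = coprime⇒AP-hits-multiple (prime∧∤⇒coprime k-prime k∤d) b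
  in Blowup-∤ (AP⊆Aₖ i i<k) k∣term
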